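{- Consider the list-scheduling procedure run on a vector $(F_j)_{j\in J}\in\mathbb{R}_{\ge0}^J$ respecting the precedence constraints. Let $\theta\in(0,1]$ be a number such that for every $j\prec j'$ we have $F_{j'}-F_j\ge\theta p_j$. Then for every job $j^*$, $T_{\mathsf{idle}}\le\frac{F_{j^*}}{\theta}+p_{j^*}$.
   Context: Setting: jobs $J$ with sizes $p_j\in\mathbb{Z}_{\ge0}$, $m$ identical machines, precedence constraints $j\prec j'$. $(F_j)$ respects the precedence constraints if $F_j\le F_{j'}$ whenever $j\prec j'$. List scheduling: process jobs $j$ in non-decreasing order of $F_j$, breaking ties first so that $j'\prec j''$ implies $j'$ is processed before $j''$, and then arbitrarily; for the current job $j$, let $t=\max_{j'\prec j}\tilde C_{j'}$ (0 if there is no such $j'$), find the minimum $t'\ge t$ such that scheduling $j$ in $(t',t'+p_j]$ does not make any unit time slot covered by $m+1$ scheduled intervals, and set $\tilde S_j=t'$, $\tilde C_j=t'+p_j$. Fix a job $j^*$ and consider the partial schedule at the end of the iteration handling $j^*$. A unit slot $(t-1,t]$ is busy if exactly $m$ scheduled intervals cover it and idle otherwise; $T_{\mathsf{idle}}$ is the number of idle unit slots before $\tilde C_{j^*}$ in this partial schedule.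
   Formalization: The entries of the vector $(F_j)_{j\in J}$ and the number $\theta$ are rational rather than real. -}

module Defs where

open import Data.Nat using (ℕ; zero; suc; _+_; _<_; _≤_; _<ᵇ_; _≤ᵇ_; _≡ᵇ_)
open import Data.Bool using (Bool; true; false; if_then_else_; _∧_; not)
open import Data.Fin using (Fin; toℕ)
open import Data.List using (List; []; _∷_; allFin; upTo; map)
open import Data.Product using (_×_; Σ)
open import Data.Integer using (+_)
open import Data.Rational using (ℚ; _/_; _÷_; 0ℚ; positive)
import Data.Rational as ℚ
open import Data.Rational.Properties using (pos⇒nonZero)
open import Function using (Injective)
open import Relation.Binary.PropositionalEquality using (_≡_)
open import Relation.Nullary using (¬_)

ℕ→ℚ : ℕ → ℚ
ℕ→ℚ k = (+ k) / 1

divPos : (a θ : ℚ) → 0ℚ ℚ.< θ → ℚ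
divPos a θ h = _÷_ a θ {{pos⇒nonZero θ {{positive h}}}}

count : {A : Set} → (A → Bool) → List A → ℕ
count f [] = 0
count f (x ∷ xs) = if f x then suc (count f xs) else count f xs

-- Jobs are Fin n; σ : Fin n → Fin n lists the jobs in processing order
-- (σ k is the job handled in iteration k); S j is the start time S̃_j,
-- so job j occupies (S j , S j + p j].
-- cover σ p S k t = number of intervals of the jobs handled in iterations
-- 0 .. k-1 (i.e. positions < k) that cover the unit slot (t-1, t].
cover : {n : ℕ} → (σ : Fin n → Fin n) → (p S : Fin n → ℕ) → (k t : ℕ) → ℕ
cover {n} σ p S k t =
  count (λ i → (toℕ i <ᵇ k) ∧ ((S (σ i) <ᵇ t) ∧ (t ≤ᵇ S (σ i) + p (σ i)))) (allFin n)

ValidOrder : {n : ℕ} → (_≺_ : Fin n → Fin n → Set) → (F : Fin n → ℚ)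
           → (σ : Fin n → Fin n) → Set
ValidOrder {n} _≺_ F σ =
  Injective _≡_ _≡_ σ
  × ((a b : Fin n) → toℕ a < toℕ b → F (σ a) ℚ.≤ F (σ b))
  × ((a b : Fin n) → σ a ≺ σ b → toℕ a < toℕ b)

-- S is the output of list scheduling with m machines along the order σ:
-- in iteration k, for job j = σ k, S j is the minimum t' ≥ t := max_{j'≺j} C̃_{j'}
-- (0 if no predecessor) such that placing j in (t', t' + p j] leaves every
-- unit slot covered by at most m intervals (among jobs handled so far).
ListSchedule : {n : ℕ} → (m : ℕ) → (p : Fin n → ℕ) → (_≺_ : Fin n → Fin n → Set)
             → (σ : Fin n → Fin n) → (S : Fin n → ℕ) → Set
ListSchedule {n} m p _≺_ σ S =
  (k : Fin n) →
    ((j' : Fin n) → j' ≺ σ k → S j' + p j' ≤ S (σ k))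
    × ((t : ℕ) → S (σ k) < t → t ≤ S (σ k) + p (σ k)
         → suc (cover σ p S (toℕ k) t) ≤ m)
    × ((t' : ℕ) → t' < S (σ k) → ((j' : Fin n) → j' ≺ σ k → S j' + p j' ≤ t')
         → ¬ ((t : ℕ) → t' < t → t ≤ t' + p (σ k)
                → suc (cover σ p S (toℕ k) t) ≤ m))

-- T_idle: number of idle unit slots (t-1,t], 1 ≤ t ≤ C̃_{j*}, in the partial
-- schedule at the end of iteration k (jobs at positions ≤ k), a slot being
-- busy iff exactly m scheduled intervals cover it.
Tidle : {n : ℕ} → (m : ℕ) → (σ : Fin n → Fin n) → (p S : Fin n → ℕ) → (k : Fin n) → ℕ
Tidle m σ p S k =
  count (λ t → not (cover σ p S (suc (toℕ k)) t ≡ᵇ m))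
        (map suc (upTo (S (σ k) + p (σ k))))

-- Let I(s) be the number of idle slots in (0, s] of the partial schedule.  By induction along
-- the processing order, θ · I(S̃_j) ≤ F_j.  Take the last idle slot (u, u + 1] before S̃_j: it
-- was already idle when j was scheduled, yet j was not started at u.  So either a predecessor
-- j' ≺ j still ran at u + 1, and θ · I(u + 1) ≤ θ · (I(S̃_j') + p_j') ≤ F_j' + (F_j - F_j') = F_j;
-- or some later slot was saturated, so the coverage by earlier jobs rises at some v ≥ u + 1,
-- where an earlier job i starts, and θ · I(u + 1) ≤ θ · I(S̃_i) ≤ F_i ≤ F_j.  Finally
-- T_idle = I(S̃_j* + p_j*) ≤ I(S̃_j*) + p_j*.
module Submission where

open import Defs
open import Data.Nat using (ℕ; _≤_)
open import Data.Fin using (Fin)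
open import Data.Rational using (ℚ; 0ℚ; 1ℚ; _+_; _*_; _-_; _<_)
import Data.Rational as ℚ
open import Relation.Binary.PropositionalEquality using (_≡_)

open import Data.Bool.Base using (Bool; true; false; T; not; _∧_; _∨_; if_then_else_)
open import Data.Bool.Properties using (T-∧; T-∨)
open import Data.Empty using (⊥-elim)
open import Data.Fin.Base using (zero; suc; toℕ; punchOut)
open import Data.Fin.Induction using (<-wellFounded)
open import Data.Fin.Properties
  using (any?; _≟_; injective⇒≤; punchOut-injective; toℕ-injective; suc-injective; 0≢1+n)
import Data.Integer as ℤ
import Data.Integer.Properties as ℤ
open import Data.List.Base using ([]; _∷_; _++_; [_]; map; tabulate; upTo; allFin)
import Data.List.Properties as List
open import Data.Nat.Base as ℕ using (zero; suc; z≤n; s≤s)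
import Data.Nat.Coprimality as Coprimality
import Data.Nat.Properties as ℕ
open import Data.Product using (_×_; _,_; proj₁; proj₂; ∃-syntax)
open import Data.Rational.Base using (mkℚ; *≤*; positive; 1/_)
import Data.Rational.Properties as ℚ
open import Data.Sum as Sum using (_⊎_; inj₁; inj₂)
open import Function using (_∘_; id)
open import Function.Bundles using (module Equivalence)
open import Function.Definitions using (Injective; StrictlySurjective)
open import Induction.WellFounded using (module All)
open import Level using (0ℓ)
open import Relation.Binary.PropositionalEquality
  using (_≢_; refl; sym; trans; cong; cong₂; subst; subst₂; module ≡-Reasoning)
open import Relation.Nullary using (¬_; yes; no; contradiction)
open import Relation.Nullary.Decidable using (decidable-stable)

T-not⇒¬T : ∀ {b} → T (not b) → ¬ T b
T-not⇒¬T {false} _ ()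
T-not⇒¬T {true} ()

module _ {A : Set} where

  count-mono : ∀ {f g : A → Bool} → (∀ x → T (f x) → T (g x)) → ∀ xs → count f xs ≤ count g xs
  count-mono f⇒g [] = z≤n
  count-mono {f} {g} f⇒g (x ∷ xs) with f x | g x | f⇒g x
  ... | true  | true  | _      = s≤s (count-mono f⇒g xs)
  ... | true  | false | fx⇒gx = ⊥-elim (fx⇒gx _)
  ... | false | true  | _      = ℕ.m≤n⇒m≤1+n (count-mono f⇒g xs)
  ... | false | false | _      = count-mono f⇒g xs

  count-<⇒∃ : ∀ {f g : A → Bool} xs → count f xs ℕ.< count g xs → ∃[ x ] T (g x) × ¬ T (f x)
  count-<⇒∃ [] ()
  count-<⇒∃ {f} {g} (x ∷ xs) f<g with f x in fx | g x in gx
  ... | true  | true  = count-<⇒∃ xs (ℕ.≤-pred f<g)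
  ... | true  | false = count-<⇒∃ xs (ℕ.<-trans (ℕ.n<1+n _) f<g)
  ... | false | true  = x , subst T (sym gx) _ , subst T fx
  ... | false | false = count-<⇒∃ xs f<g

  count-∨ : ∀ (f g : A → Bool) xs → count (λ x → f x ∨ g x) xs ≤ count f xs ℕ.+ count g xs
  count-∨ f g [] = z≤n
  count-∨ f g (x ∷ xs) with f x | g x
  ... | true  | true  = s≤s (ℕ.≤-trans (count-∨ f g xs) (ℕ.+-monoʳ-≤ (count f xs) (ℕ.n≤1+n _)))
  ... | true  | false = s≤s (count-∨ f g xs)
  ... | false | true  = ℕ.≤-trans (s≤s (count-∨ f g xs)) (ℕ.≤-reflexive (sym (ℕ.+-suc _ _)))
  ... | false | false = count-∨ f g xs

  count-++ : ∀ (f : A → Bool) xs ys → count f (xs ++ ys) ≡ count f xs ℕ.+ count f ys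
  count-++ f [] ys = refl
  count-++ f (x ∷ xs) ys with f x
  ... | true  = cong suc (count-++ f xs ys)
  ... | false = count-++ f xs ys

  count-[-]≤1 : ∀ (f : A → Bool) x → count f [ x ] ≤ 1
  count-[-]≤1 f x with f x
  ... | true  = ℕ.≤-refl
  ... | false = z≤n

  count-tabulate≡0 : ∀ {n} {f : A → Bool} (g : Fin n → A) → (∀ i → ¬ T (f (g i)))
                   → count f (tabulate g) ≡ 0
  count-tabulate≡0 {zero} g none = refl
  count-tabulate≡0 {suc n} {f} g none with f (g zero) | none zero
  ... | true  | ¬fg0 = ⊥-elim (¬fg0 _)
  ... | false | _    = count-tabulate≡0 (g ∘ suc) (none ∘ suc)

  count-tabulate≤1 : ∀ {n} {f : A → Bool} (g : Fin n → A)
                   → (∀ i j → T (f (g i)) → T (f (g j)) → i ≡ j) → count f (tabulate g) ≤ 1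
  count-tabulate≤1 {zero} g unique = z≤n
  count-tabulate≤1 {suc n} {f} g unique with f (g zero) in fg0
  ... | true  = s≤s (ℕ.≤-reflexive (count-tabulate≡0 (g ∘ suc)
                  (λ i fgi → 0≢1+n (unique zero (suc i) (subst T (sym fg0) _) fgi))))
  ... | false = count-tabulate≤1 (g ∘ suc) (λ i j fgi fgj → suc-injective (unique _ _ fgi fgj))

countSlots : (ℕ → Bool) → ℕ → ℕ
countSlots f s = count f (map suc (upTo s))

countSlots-suc : ∀ f s → countSlots f (suc s) ≡ countSlots f s ℕ.+ count f [ suc s ]
countSlots-suc f s = begin
  count f (map suc (upTo (suc s)))         ≡⟨ cong (count f ∘ map suc) (List.upTo-∷ʳ s) ⟨
  count f (map suc (upTo s ++ [ s ]))      ≡⟨ cong (count f) (List.map-++ suc (upTo s) [ s ]) ⟩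
  count f (map suc (upTo s) ++ [ suc s ])  ≡⟨ count-++ f (map suc (upTo s)) [ suc s ] ⟩
  countSlots f s ℕ.+ count f [ suc s ]     ∎
  where open ≡-Reasoning

countSlots-≤-suc : ∀ f s → countSlots f s ≤ countSlots f (suc s)
countSlots-≤-suc f s = ℕ.≤-trans (ℕ.m≤m+n _ _) (ℕ.≤-reflexive (sym (countSlots-suc f s)))

countSlots-suc-≤ : ∀ f s → countSlots f (suc s) ≤ suc (countSlots f s)
countSlots-suc-≤ f s = begin
  countSlots f (suc s)                  ≡⟨ countSlots-suc f s ⟩
  countSlots f s ℕ.+ count f [ suc s ]  ≤⟨ ℕ.+-monoʳ-≤ (countSlots f s) (count-[-]≤1 f (suc s)) ⟩
  countSlots f s ℕ.+ 1                  ≡⟨ ℕ.+-comm (countSlots f s) 1 ⟩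
  suc (countSlots f s)                  ∎
  where open ℕ.≤-Reasoning

countSlots-mono : ∀ f {s s'} → s ≤ s' → countSlots f s ≤ countSlots f s'
countSlots-mono f {s' = zero} z≤n = ℕ.≤-refl
countSlots-mono f {s' = suc s'} s≤1+s' with ℕ.m≤n⇒m<n∨m≡n s≤1+s'
... | inj₁ s<1+s' = ℕ.≤-trans (countSlots-mono f (ℕ.≤-pred s<1+s')) (countSlots-≤-suc f s')
... | inj₂ refl   = ℕ.≤-refl

countSlots-+-≤ : ∀ f s d → countSlots f (s ℕ.+ d) ≤ countSlots f s ℕ.+ d
countSlots-+-≤ f s zero = begin
  countSlots f (s ℕ.+ 0)  ≡⟨ cong (countSlots f) (ℕ.+-identityʳ s) ⟩
  countSlots f s          ≡⟨ ℕ.+-identityʳ (countSlots f s) ⟨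
  countSlots f s ℕ.+ 0    ∎
  where open ℕ.≤-Reasoning
countSlots-+-≤ f s (suc d) = begin
  countSlots f (s ℕ.+ suc d)    ≡⟨ cong (countSlots f) (ℕ.+-suc s d) ⟩
  countSlots f (suc (s ℕ.+ d))  ≤⟨ countSlots-suc-≤ f (s ℕ.+ d) ⟩
  suc (countSlots f (s ℕ.+ d))  ≤⟨ s≤s (countSlots-+-≤ f s d) ⟩
  suc (countSlots f s ℕ.+ d)    ≡⟨ ℕ.+-suc (countSlots f s) d ⟨
  countSlots f s ℕ.+ suc d      ∎
  where open ℕ.≤-Reasoning

countSlots-last-true : ∀ f s → countSlots f s ≡ 0
                     ⊎ ∃[ u ] suc u ≤ s × T (f (suc u)) × countSlots f s ≡ countSlots f (suc u)
countSlots-last-true f zero = inj₁ refl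
countSlots-last-true f (suc s) with f (suc s) in fs
... | true  = inj₂ (s , ℕ.≤-refl , subst T (sym fs) _ , refl)
... | false = Sum.map (trans unchanged)
                (λ (u , u<s , fu , same) → u , ℕ.m≤n⇒m≤1+n u<s , fu , trans unchanged same)
                (countSlots-last-true f s)
  where
  unchanged : countSlots f (suc s) ≡ countSlots f s
  unchanged = trans (countSlots-suc f s)
                (trans (cong (λ b → countSlots f s ℕ.+ (if b then 1 else 0)) fs) (ℕ.+-identityʳ _))

ascent : ∀ (f : ℕ → ℕ) {u t} → u ≤ t → f u ℕ.< f t → ∃[ v ] u ≤ v × f v ℕ.< f (suc v)
ascent f {u} u≤t fu<ft with ℕ.m≤n⇒∃[o]m+o≡n u≤t
... | d , refl = go d fu<ft
  where
  go : ∀ d → f u ℕ.< f (u ℕ.+ d) → ∃[ v ] u ≤ v × f v ℕ.< f (suc v)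
  go zero fu<fu = contradiction fu<fu (ℕ.<-irrefl (cong f (sym (ℕ.+-identityʳ u))))
  go (suc d) fu<f[u+1+d] with f u ℕ.<? f (u ℕ.+ d)
  ... | yes fu<f[u+d] = go d fu<f[u+d]
  ... | no  fu≮f[u+d] =
    u ℕ.+ d , ℕ.m≤m+n u d
            , ℕ.≤-<-trans (ℕ.≮⇒≥ fu≮f[u+d]) (subst (λ x → f u ℕ.< f x) (ℕ.+-suc u d) fu<f[u+1+d])

injective⇒strictlySurjective : ∀ {n} {f : Fin n → Fin n} → Injective _≡_ _≡_ f → StrictlySurjective _≡_ f
injective⇒strictlySurjective {zero} _ ()
injective⇒strictlySurjective {suc n} {f} f-inj y with any? (λ x → f x ≟ y)
... | yes hit = hit
... | no miss = contradiction (injective⇒≤ punched-inj) ℕ.1+n≰n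
  where
  y≢f : ∀ x → y ≢ f x
  y≢f x y≡fx = miss (x , sym y≡fx)
  punched-inj : Injective _≡_ _≡_ (λ x → punchOut (y≢f x))
  punched-inj eq = f-inj (punchOut-injective (y≢f _) (y≢f _) eq)

ℕ→ℚ≡mkℚ : ∀ k → ℕ→ℚ k ≡ mkℚ (ℤ.+ k) 0 (Coprimality.sym (Coprimality.1-coprimeTo k))
ℕ→ℚ≡mkℚ k = ℚ.normalize-coprime (Coprimality.sym (Coprimality.1-coprimeTo k))

ℕ→ℚ-mono-≤ : ∀ {a b} → a ≤ b → ℕ→ℚ a ℚ.≤ ℕ→ℚ b
ℕ→ℚ-mono-≤ {a} {b} a≤b rewrite ℕ→ℚ≡mkℚ a | ℕ→ℚ≡mkℚ b =
  *≤* (subst₂ ℤ._≤_ (sym (ℤ.*-identityʳ (ℤ.+ a))) (sym (ℤ.*-identityʳ (ℤ.+ b))) (ℤ.+≤+ a≤b))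

ℕ→ℚ-homo-+ : ∀ a b → ℕ→ℚ (a ℕ.+ b) ≡ ℕ→ℚ a + ℕ→ℚ b
-- The middle term is ℚ's _+_ unfolded on two integers over the denominator 1.
ℕ→ℚ-homo-+ a b = begin
  ℤ.+ (a ℕ.+ b) ℚ./ 1                          ≡⟨ cong (ℚ._/ 1) (cong₂ ℤ._+_ (ℤ.*-identityʳ (ℤ.+ a)) (ℤ.*-identityʳ (ℤ.+ b))) ⟨
  (ℤ.+ a ℤ.* ℤ.+ 1 ℤ.+ ℤ.+ b ℤ.* ℤ.+ 1) ℚ./ 1  ≡⟨ cong₂ _+_ (ℕ→ℚ≡mkℚ a) (ℕ→ℚ≡mkℚ b) ⟨
  ℕ→ℚ a + ℕ→ℚ b                                ∎
  where open ≡-Reasoning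

p+[q-p]≡q : ∀ p q → p + (q - p) ≡ q
p+[q-p]≡q p q = begin
  p + (q - p)      ≡⟨ cong (p +_) (ℚ.+-comm q (ℚ.- p)) ⟩
  p + (ℚ.- p + q)  ≡⟨ ℚ.+-assoc p (ℚ.- p) q ⟨
  (p + ℚ.- p) + q  ≡⟨ cong (_+ q) (ℚ.+-inverseʳ p) ⟩
  0ℚ + q           ≡⟨ ℚ.+-identityˡ q ⟩
  q                ∎
  where open ≡-Reasoning

*≤⇒≤divPos : ∀ {x a θ} (θ>0 : 0ℚ < θ) → θ * x ℚ.≤ a → x ℚ.≤ divPos a θ θ>0
*≤⇒≤divPos {x} {a} {θ} θ>0 θx≤a = ℚ.*-cancelˡ-≤-pos θ (subst (θ * x ℚ.≤_) (sym θ[a/θ]≡a) θx≤a)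
  where
  instance
    θ-pos : ℚ.Positive θ
    θ-pos = positive θ>0
    θ≢0 : ℚ.NonZero θ
    θ≢0 = ℚ.pos⇒nonZero θ
  θ[a/θ]≡a : θ * (a * 1/ θ) ≡ a
  θ[a/θ]≡a = begin
    θ * (a * 1/ θ)  ≡⟨ cong (θ *_) (ℚ.*-comm a (1/ θ)) ⟩
    θ * (1/ θ * a)  ≡⟨ ℚ.*-assoc θ (1/ θ) a ⟨
    (θ * 1/ θ) * a  ≡⟨ cong (_* a) (ℚ.*-inverseʳ θ) ⟩
    1ℚ * a          ≡⟨ ℚ.*-identityˡ a ⟩
    a               ∎
    where open ≡-Reasoning

module _ {n : ℕ} (σ : Fin n → Fin n) (p S : Fin n → ℕ) where

  Covers : Fin n → ℕ → Set
  Covers j t = S j ℕ.< t × t ≤ S j ℕ.+ p j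

  -- cover σ p S k t unfolds to count (inCover k t) (allFin n).
  inCover : ℕ → ℕ → Fin n → Bool
  inCover k t i = (toℕ i ℕ.<ᵇ k) ∧ ((S (σ i) ℕ.<ᵇ t) ∧ (t ℕ.≤ᵇ S (σ i) ℕ.+ p (σ i)))

  inCover⇒ : ∀ {k t} i → T (inCover k t i) → toℕ i ℕ.< k × Covers (σ i) t
  inCover⇒ i i∈ with Equivalence.to T-∧ i∈
  ... | i<k , covers with Equivalence.to T-∧ covers
  ...   | S<t , t≤C = ℕ.<ᵇ⇒< _ _ i<k , ℕ.<ᵇ⇒< _ _ S<t , ℕ.≤ᵇ⇒≤ _ _ t≤C

  ⇒inCover : ∀ {k t} i → toℕ i ℕ.< k → Covers (σ i) t → T (inCover k t i)
  ⇒inCover i i<k (S<t , t≤C) =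
    Equivalence.from T-∧ (ℕ.<⇒<ᵇ i<k , Equivalence.from T-∧ (ℕ.<⇒<ᵇ S<t , ℕ.≤⇒≤ᵇ t≤C))

  cover-mono : ∀ {k k'} → k ≤ k' → ∀ t → cover σ p S k t ≤ cover σ p S k' t
  cover-mono {k} {k'} k≤k' t = count-mono grow (allFin n)
    where
    grow : ∀ i → T (inCover k t i) → T (inCover k' t i)
    grow i i∈ with inCover⇒ {k} {t} i i∈
    ... | i<k , covers = ⇒inCover {k'} {t} i (ℕ.<-≤-trans i<k k≤k') covers

  cover-suc-≤ : ∀ k t → cover σ p S (suc k) t ≤ suc (cover σ p S k t)
  cover-suc-≤ k t = begin
    cover σ p S (suc k) t                            ≤⟨ count-mono split (allFin n) ⟩
    count (λ i → inCover k t i ∨ at-k i) (allFin n)  ≤⟨ count-∨ (inCover k t) at-k (allFin n) ⟩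
    cover σ p S k t ℕ.+ count at-k (allFin n)        ≤⟨ ℕ.+-monoʳ-≤ _ (count-tabulate≤1 id at-k-unique) ⟩
    cover σ p S k t ℕ.+ 1                            ≡⟨ ℕ.+-comm _ 1 ⟩
    suc (cover σ p S k t)                            ∎
    where
    open ℕ.≤-Reasoning
    at-k : Fin n → Bool
    at-k i = toℕ i ℕ.≡ᵇ k
    at-k-unique : ∀ i j → T (at-k i) → T (at-k j) → i ≡ j
    at-k-unique i j i≡k j≡k = toℕ-injective (trans (ℕ.≡ᵇ⇒≡ _ _ i≡k) (sym (ℕ.≡ᵇ⇒≡ _ _ j≡k)))
    split : ∀ i → T (inCover (suc k) t i) → T (inCover k t i ∨ at-k i)
    split i i∈ with inCover⇒ {suc k} {t} i i∈
    ... | i<1+k , covers with ℕ.m≤n⇒m<n∨m≡n (ℕ.≤-pred i<1+k)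
    ...   | inj₁ i<k = Equivalence.from T-∨ (inj₁ (⇒inCover {k} {t} i i<k covers))
    ...   | inj₂ i≡k = Equivalence.from T-∨ (inj₂ (ℕ.≡⇒≡ᵇ _ _ i≡k))

  cover-rises-at : ∀ {k t} → cover σ p S k t ℕ.< cover σ p S (suc k) t
                 → ∃[ i ] toℕ i ≡ k × Covers (σ i) t
  cover-rises-at {k} {t} lt with count-<⇒∃ (allFin n) lt
  ... | i , new , ¬old with inCover⇒ {suc k} {t} i new
  ...   | i<1+k , covers =
    i , ℕ.≤-antisym (ℕ.≤-pred i<1+k) (ℕ.≮⇒≥ (λ i<k → ¬old (⇒inCover {k} {t} i i<k covers))) , covers

  cover-rises⇒start : ∀ {k v} → cover σ p S k v ℕ.< cover σ p S k (suc v)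
                    → ∃[ i ] toℕ i ℕ.< k × S (σ i) ≡ v
  cover-rises⇒start {k} {v} lt with count-<⇒∃ (allFin n) lt
  ... | i , new , ¬old with inCover⇒ {k} {suc v} i new
  ...   | i<k , S<1+v , 1+v≤C =
    i , i<k , ℕ.≤-antisym (ℕ.≤-pred S<1+v)
                (ℕ.≮⇒≥ (λ S<v → ¬old (⇒inCover {k} {v} i i<k (S<v , ℕ.≤-trans (ℕ.n≤1+n v) 1+v≤C))))

-- Tidle m σ p S k unfolds to countSlots (idle m σ p S (suc (toℕ k))) (S (σ k) ℕ.+ p (σ k)).
idle : ∀ {n} → ℕ → (Fin n → Fin n) → (p S : Fin n → ℕ) → ℕ → ℕ → Bool
idle m σ p S k t = not (cover σ p S k t ℕ.≡ᵇ m)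

module Feasible {n : ℕ} (m : ℕ) (p : Fin n → ℕ) (_≺_ : Fin n → Fin n → Set) (σ : Fin n → Fin n)
                (S : Fin n → ℕ) (schedule : ListSchedule m p _≺_ σ S) where

  cover≤m : ∀ k t → cover σ p S k t ≤ m
  cover≤m zero t = subst (_≤ m) (sym (count-tabulate≡0 {f = inCover σ p S 0 t} id (λ _ ()))) z≤n
  cover≤m (suc k) t with ℕ.≤-<-connex (cover σ p S (suc k) t) (cover σ p S k t)
  ... | inj₁ no-rise = ℕ.≤-trans no-rise (cover≤m k t)
  ... | inj₂ rise with cover-rises-at σ p S rise
  ...   | i , refl , (S<t , t≤C) =
    ℕ.≤-trans (cover-suc-≤ σ p S (toℕ i) t) (proj₁ (proj₂ (schedule i)) t S<t t≤C)

  idle⇒unsaturated : ∀ {k K t} → k ≤ K → T (idle m σ p S K t) → cover σ p S k t ℕ.< m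
  idle⇒unsaturated {K = K} {t = t} k≤K t-idle =
    ℕ.≤-<-trans (cover-mono σ p S k≤K t)
                (ℕ.≤∧≢⇒< (cover≤m K t) (T-not⇒¬T t-idle ∘ ℕ.≡⇒≡ᵇ _ _))

module IdleBound {n : ℕ} (m : ℕ) (p : Fin n → ℕ) (_≺_ : Fin n → Fin n → Set) (F : Fin n → ℚ)
                 (F≥0 : ∀ j → 0ℚ ℚ.≤ F j) (θ : ℚ) (θ>0 : 0ℚ < θ)
                 (gap : ∀ j j' → j ≺ j' → θ * ℕ→ℚ (p j) ℚ.≤ F j' - F j)
                 (σ : Fin n → Fin n) (order : ValidOrder _≺_ F σ)
                 (S : Fin n → ℕ) (schedule : ListSchedule m p _≺_ σ S) (K : ℕ) where

  open Feasible m p _≺_ σ S schedule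

  private
    instance
      θ≥0 : ℚ.NonNegative θ
      θ≥0 = ℚ.pos⇒nonNeg θ {{positive θ>0}}

    σ-injective : Injective _≡_ _≡_ σ
    σ-injective = proj₁ order

    F-along-σ : ∀ i j → toℕ i ℕ.< toℕ j → F (σ i) ℚ.≤ F (σ j)
    F-along-σ = proj₁ (proj₂ order)

    ≺-along-σ : ∀ i j → σ i ≺ σ j → toℕ i ℕ.< toℕ j
    ≺-along-σ = proj₂ (proj₂ order)

  idleSlots : ℕ → ℕ
  idleSlots = countSlots (idle m σ p S K)

  θ*-mono : ∀ {x y} → x ≤ y → θ * ℕ→ℚ x ℚ.≤ θ * ℕ→ℚ y
  θ*-mono = ℚ.*-monoˡ-≤-nonNeg θ ∘ ℕ→ℚ-mono-≤

  module _ (a : Fin n) (a≤K : toℕ a ≤ K)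
           (ih : ∀ b → toℕ b ℕ.< toℕ a → θ * ℕ→ℚ (idleSlots (S (σ b))) ℚ.≤ F (σ b)) where

    bound-via-running : ∀ {U} b → σ b ≺ σ a → U ≤ S (σ b) ℕ.+ p (σ b)
                      → θ * ℕ→ℚ (idleSlots U) ℚ.≤ F (σ a)
    bound-via-running {U} b b≺a U≤C = begin
      θ * ℕ→ℚ (idleSlots U)                              ≤⟨ θ*-mono (countSlots-mono _ U≤C) ⟩
      θ * ℕ→ℚ (idleSlots (S (σ b) ℕ.+ p (σ b)))          ≤⟨ θ*-mono (countSlots-+-≤ _ (S (σ b)) (p (σ b))) ⟩
      θ * ℕ→ℚ (idleSlots (S (σ b)) ℕ.+ p (σ b))          ≡⟨ cong (θ *_) (ℕ→ℚ-homo-+ (idleSlots (S (σ b))) (p (σ b))) ⟩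
      θ * (ℕ→ℚ (idleSlots (S (σ b))) + ℕ→ℚ (p (σ b)))    ≡⟨ ℚ.*-distribˡ-+ θ _ _ ⟩
      θ * ℕ→ℚ (idleSlots (S (σ b))) + θ * ℕ→ℚ (p (σ b))  ≤⟨ ℚ.+-mono-≤ (ih b b<a) (gap (σ b) (σ a) b≺a) ⟩
      F (σ b) + (F (σ a) - F (σ b))                      ≡⟨ p+[q-p]≡q (F (σ b)) (F (σ a)) ⟩
      F (σ a)                                            ∎
      where
      open ℚ.≤-Reasoning
      b<a : toℕ b ℕ.< toℕ a
      b<a = ≺-along-σ b a b≺a

    bound-via-later-start : ∀ {U} i → toℕ i ℕ.< toℕ a → U ≤ S (σ i)
                          → θ * ℕ→ℚ (idleSlots U) ℚ.≤ F (σ a)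
    bound-via-later-start {U} i i<a U≤S = begin
      θ * ℕ→ℚ (idleSlots U)          ≤⟨ θ*-mono (countSlots-mono _ U≤S) ⟩
      θ * ℕ→ℚ (idleSlots (S (σ i)))  ≤⟨ ih i i<a ⟩
      F (σ i)                        ≤⟨ F-along-σ i a i<a ⟩
      F (σ a)                        ∎
      where open ℚ.≤-Reasoning

    bound-via-predecessor : ∀ {u j'} → j' ≺ σ a → u ℕ.< S j' ℕ.+ p j'
                          → θ * ℕ→ℚ (idleSlots (suc u)) ℚ.≤ F (σ a)
    bound-via-predecessor {u} {j'} j'≺a u<C =
      let b , σb≡j' = injective⇒strictlySurjective σ-injective j'
      in bound-via-running b (subst (_≺ σ a) (sym σb≡j') j'≺a)
                             (subst (λ j → suc u ≤ S j ℕ.+ p j) (sym σb≡j') u<C)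

    bound-via-saturated : ∀ {u t} → T (idle m σ p S K (suc u)) → u ℕ.< t
                        → m ≤ cover σ p S (toℕ a) t → θ * ℕ→ℚ (idleSlots (suc u)) ℚ.≤ F (σ a)
    bound-via-saturated {u} U-idle u<t saturated =
      let v , U≤v , rise = ascent (cover σ p S (toℕ a)) u<t
                             (ℕ.<-≤-trans (idle⇒unsaturated {t = suc u} a≤K U-idle) saturated)
          i , i<a , Si≡v = cover-rises⇒start σ p S {v = v} rise
      in bound-via-later-start i i<a (subst (suc u ≤_) (sym Si≡v) U≤v)

    -- Minimality of S̃_j only refutes the start u, so the bound is reached by contradiction
    -- (≤ on ℚ is decidable).
    bound-at-idle-slot : ∀ {u} → suc u ≤ S (σ a) → T (idle m σ p S K (suc u))
                       → θ * ℕ→ℚ (idleSlots (suc u)) ℚ.≤ F (σ a)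
    bound-at-idle-slot {u} U≤S U-idle = decidable-stable (_ ℚ.≤? _) λ ¬bound →
      proj₂ (proj₂ (schedule a)) u U≤S
        (λ j' j'≺j → ℕ.≮⇒≥ (¬bound ∘ bound-via-predecessor j'≺j))
        (λ t u<t _ → ℕ.≮⇒≥ (¬bound ∘ bound-via-saturated U-idle u<t ∘ ℕ.≤-pred))

    idleSlots-bound-step : θ * ℕ→ℚ (idleSlots (S (σ a))) ℚ.≤ F (σ a)
    idleSlots-bound-step =
      Sum.[ no-idle-slot , after-last-idle-slot ]′ (countSlots-last-true (idle m σ p S K) (S (σ a)))
      where
      no-idle-slot : idleSlots (S (σ a)) ≡ 0 → θ * ℕ→ℚ (idleSlots (S (σ a))) ℚ.≤ F (σ a)
      no-idle-slot none = begin
        θ * ℕ→ℚ (idleSlots (S (σ a)))  ≡⟨ cong (λ x → θ * ℕ→ℚ x) none ⟩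
        θ * 0ℚ                         ≡⟨ ℚ.*-zeroʳ θ ⟩
        0ℚ                             ≤⟨ F≥0 (σ a) ⟩
        F (σ a)                        ∎
        where open ℚ.≤-Reasoning
      after-last-idle-slot : ∃[ u ] suc u ≤ S (σ a) × T (idle m σ p S K (suc u))
                                  × idleSlots (S (σ a)) ≡ idleSlots (suc u)
                           → θ * ℕ→ℚ (idleSlots (S (σ a))) ℚ.≤ F (σ a)
      after-last-idle-slot (u , U≤S , U-idle , same) =
        subst (λ x → θ * ℕ→ℚ x ℚ.≤ F (σ a)) (sym same) (bound-at-idle-slot U≤S U-idle)

  idleSlots-bound : ∀ a → toℕ a ≤ K → θ * ℕ→ℚ (idleSlots (S (σ a))) ℚ.≤ F (σ a)
  idleSlots-bound = All.wfRec <-wellFounded 0ℓ _ λ a ih a≤K →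
    idleSlots-bound-step a a≤K (λ b b<a → ih b<a (ℕ.≤-trans (ℕ.<⇒≤ b<a) a≤K))

lemma3p7 : (n m : ℕ) → 1 ≤ m → (p : Fin n → ℕ) → (_≺_ : Fin n → Fin n → Set)
    → (F : Fin n → ℚ) → ((j : Fin n) → 0ℚ ℚ.≤ F j)
    → ((j j' : Fin n) → j ≺ j' → F j ℚ.≤ F j')
    → (θ : ℚ) → (θ>0 : 0ℚ < θ) → θ ℚ.≤ 1ℚ
    → ((j j' : Fin n) → j ≺ j' → θ * ℕ→ℚ (p j) ℚ.≤ F j' - F j)
    → (σ : Fin n → Fin n) → ValidOrder _≺_ F σ
    → (S : Fin n → ℕ) → ListSchedule m p _≺_ σ S
    → (jstar k : Fin n) → σ k ≡ jstar
    → ℕ→ℚ (Tidle m σ p S k) ℚ.≤ divPos (F jstar) θ θ>0 + ℕ→ℚ (p jstar)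
lemma3p7 n m _ p _≺_ F F≥0 _ θ θ>0 _ gap σ order S schedule .(σ k) k refl = begin
  ℕ→ℚ (Tidle m σ p S k)                      ≤⟨ ℕ→ℚ-mono-≤ (countSlots-+-≤ _ (S (σ k)) (p (σ k))) ⟩
  ℕ→ℚ (idleSlots (S (σ k)) ℕ.+ p (σ k))      ≡⟨ ℕ→ℚ-homo-+ (idleSlots (S (σ k))) (p (σ k)) ⟩
  ℕ→ℚ (idleSlots (S (σ k))) + ℕ→ℚ (p (σ k))  ≤⟨ ℚ.+-monoˡ-≤ _ (*≤⇒≤divPos θ>0 θI≤F) ⟩
  divPos (F (σ k)) θ θ>0 + ℕ→ℚ (p (σ k))     ∎
  where
  open ℚ.≤-Reasoning
  open IdleBound m p _≺_ F F≥0 θ θ>0 gap σ order S schedule (suc (toℕ k))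
  θI≤F : θ * ℕ→ℚ (idleSlots (S (σ k))) ℚ.≤ F (σ k)
  θI≤F = idleSlots-bound k (ℕ.n≤1+n _)
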